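{- Let $n\ge 1$ and let $C=(\mathbb{C}_n,\{f_i\}_{i\in V})$ and $C'=(\mathbb{C}_n,\{g_i\}_{i\in V})$ be two Boolean automata circuits of the same size $n$ and the same sign (both positive or both negative). Then their general iteration graphs $\mathcal{D}(C)$ and $\mathcal{D}(C')$ are isomorphic (as directed graphs).
   Context: A Boolean automata circuit of size $n$ has node set $V=\{0,\dots,n-1\}$, identified with $\mathbb{Z}/n\mathbb{Z}$ (so $i+1$, $i-1$ are taken mod $n$), arcs $(i,i+1)$ for $i\in V$, and local transition functions $f_i\in\{id,neg\}$, where $id(a)=a$ and $neg(a)=1-a$ on $\{0,1\}$. Configurations are vectors $x\in\{0,1\}^n$. The circuit is positive if the number of $i$ with $f_i=neg$ is even, and negative if it is odd. For a subset $P\subseteq V$, the global transition function relative to $P$ is $F^P:\{0,1\}^n\to\{0,1\}^n$ given by $F^P(x)_i=f_i(x_{i-1})$ if $i\in P$ and $F^P(x)_i=x_i$ if $i\notin P$. The general iteration graph $\mathcal{D}(C)$ is the directed graph whose vertices are the configurations $x\in\{0,1\}^n$ and which has, for each configuration $x$ and each nonempty $P\subseteq V$, an arc from $x$ to $F^P(x)$ (labelled by $P$). -}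

module Defs where

open import Data.Nat using (ℕ; suc)
open import Data.Bool using (Bool; true; false; not; if_then_else_)
open import Relation.Nullary.Decidable using (Dec)
open import Data.Bool.Properties using (T?)
open import Data.Fin using (Fin; zero; suc; toℕ)
open import Data.Vec using (Vec; lookup; tabulate; count)
open import Data.Product using (Σ; ∃; _×_)
open import Relation.Binary.PropositionalEquality using (_≡_)
open import Function.Bundles using (_↔_; Inverse)

data LocalFun : Set where
  idf negf : LocalFun

apply : LocalFun → Bool → Bool
apply idf a = a
apply negf a = not a

-- A Boolean automata circuit of size n: a local function for each node i ∈ Z/nZ.
Circuit : ℕ → Set
Circuit n = Vec LocalFun n

isNeg : LocalFun → Bool
isNeg idf = false
isNeg negf = true

negCount : ∀ {n} → Circuit n → ℕ
negCount C = count (λ f → T? (isNeg f)) C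

-- sign: true = negative (odd number of neg), false = positive
parity : ℕ → Bool
parity 0 = false
parity (suc k) = not (parity k)

sign : ∀ {n} → Circuit n → Bool
sign C = parity (negCount C)

Config : ℕ → Set
Config n = Vec Bool n

Subset : ℕ → Set
Subset n = Vec Bool n

Nonempty : ∀ {n} → Subset n → Set
Nonempty {n} P = ∃ λ (i : Fin n) → lookup P i ≡ true

prev : ∀ {m} → Fin (suc m) → Fin (suc m)
prev {m} zero = Data.Fin.fromℕ m
prev (suc i) = Data.Fin.inject₁ i

F : ∀ {m} → Circuit (suc m) → Subset (suc m) → Config (suc m) → Config (suc m)
F C P x = tabulate λ i →
  if lookup P i then apply (lookup C i) (lookup x (prev i)) else lookup x i

Arc : ∀ {m} → Circuit (suc m) → Config (suc m) → Config (suc m) → Set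
Arc C x y = ∃ λ P → Nonempty P × F C P x ≡ y

GraphIso : ∀ {m} → Circuit (suc m) → Circuit (suc m) → Set
GraphIso {m} C C' = Σ (Config (suc m) ↔ Config (suc m)) λ φ →
  ∀ x y → (Arc C x y → Arc C' (Inverse.to φ x) (Inverse.to φ y))
        × (Arc C' (Inverse.to φ x) (Inverse.to φ y) → Arc C x y)

module Submission where

-- Write nᵢ ∈ {0,1} for "fᵢ = neg", so that fᵢ(a) = a ⊕ nᵢ. Translating every configuration
-- by a fixed vector s, x ↦ x ⊕ s, turns F_C^P into F_{C'}^P for every P simultaneously as soon
-- as s_{i-1} ⊕ n'ᵢ = nᵢ ⊕ sᵢ for all i (switching of a signed cycle). Such an s is a cyclic
-- "antiderivative" of dᵢ = nᵢ ⊕ n'ᵢ, and it exists when ⊕ᵢ dᵢ = 0, i.e. when C and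
-- C' have the same sign. The translation is an involution, hence a graph isomorphism.

open import Defs
open import Algebra.Bundles using (CommutativeRing)
import Algebra.Properties.CommutativeSemigroup as CommutativeSemigroupProperties
open import Data.Bool using (Bool; true; false; not; if_then_else_; _xor_)
open import Data.Bool.Properties
  using (xor-assoc; xor-comm; xor-same; xor-identityʳ; xor-∧-commutativeRing)
open import Data.Fin using (Fin; zero; suc; fromℕ; inject₁)
open import Data.Nat using (ℕ; suc)
open import Data.Product using (∃; _,_)
open import Data.Vec using (Vec; []; _∷_; lookup; tabulate; map; zipWith; foldr′)
open import Data.Vec.Properties
  using (lookup∘tabulate; tabulate∘lookup; tabulate-cong; lookup-zipWith; lookup-map)
open import Function.Bundles using (mk↔ₛ′)
open import Relation.Binary.PropositionalEquality
  using (_≡_; refl; sym; trans; cong; cong₂; module ≡-Reasoning)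

open ≡-Reasoning

xor-interchange : ∀ a b c d → (a xor b) xor (c xor d) ≡ (a xor c) xor (b xor d)
xor-interchange =
  CommutativeSemigroupProperties.interchange
    (CommutativeRing.+-commutativeSemigroup xor-∧-commutativeRing)

xorSum : ∀ {n} → Vec Bool n → Bool
xorSum = foldr′ _xor_ false

xorSum-zipWith : ∀ {n} (u v : Vec Bool n) →
                 xorSum (zipWith _xor_ u v) ≡ xorSum u xor xorSum v
xorSum-zipWith []       []       = refl
xorSum-zipWith (a ∷ u) (b ∷ v) = begin
  (a xor b) xor xorSum (zipWith _xor_ u v) ≡⟨ cong ((a xor b) xor_) (xorSum-zipWith u v) ⟩
  (a xor b) xor (xorSum u xor xorSum v)    ≡⟨ xor-interchange a b (xorSum u) (xorSum v) ⟩
  (a xor xorSum u) xor (b xor xorSum v)    ∎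

apply≡xor-isNeg : ∀ f a → apply f a ≡ a xor isNeg f
apply≡xor-isNeg idf  a = sym (xor-identityʳ a)
apply≡xor-isNeg negf a = sym (xor-comm a true)

sign≡xorSum-isNeg : ∀ {n} (C : Circuit n) → sign C ≡ xorSum (map isNeg C)
sign≡xorSum-isNeg []         = refl
sign≡xorSum-isNeg (idf  ∷ C) = sign≡xorSum-isNeg C
sign≡xorSum-isNeg (negf ∷ C) = cong not (sign≡xorSum-isNeg C)

negDiff : ∀ {n} → Circuit n → Circuit n → Vec Bool n
negDiff C C' = zipWith _xor_ (map isNeg C) (map isNeg C')

xorSum-negDiff : ∀ {n} (C C' : Circuit n) → sign C ≡ sign C' → xorSum (negDiff C C') ≡ false
xorSum-negDiff C C' eq = begin
  xorSum (negDiff C C')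
    ≡⟨ xorSum-zipWith (map isNeg C) (map isNeg C') ⟩
  xorSum (map isNeg C) xor xorSum (map isNeg C')
    ≡⟨ sym (cong₂ _xor_ (sign≡xorSum-isNeg C) (sign≡xorSum-isNeg C')) ⟩
  sign C xor sign C'
    ≡⟨ cong (_xor sign C') eq ⟩
  sign C' xor sign C'
    ≡⟨ xor-same (sign C') ⟩
  false
    ∎

suffixXors : ∀ {n} → Vec Bool n → Vec Bool n
suffixXors []       = []
suffixXors (d ∷ ds) = xorSum ds ∷ suffixXors ds

lookup-suffixXors-inject₁ : ∀ {k} (ds : Vec Bool (suc k)) (j : Fin k) →
  lookup (suffixXors ds) (inject₁ j) ≡ lookup ds (suc j) xor lookup (suffixXors ds) (suc j)
lookup-suffixXors-inject₁ (d ∷ e ∷ es) zero    = refl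
lookup-suffixXors-inject₁ (d ∷ e ∷ es) (suc j) = lookup-suffixXors-inject₁ (e ∷ es) j

lookup-suffixXors-last : ∀ {k} (ds : Vec Bool (suc k)) → lookup (suffixXors ds) (fromℕ k) ≡ false
lookup-suffixXors-last (d ∷ [])     = refl
lookup-suffixXors-last (d ∷ e ∷ es) = lookup-suffixXors-last (e ∷ es)

cyclic-antiderivative : ∀ {m} (d : Vec Bool (suc m)) → xorSum d ≡ false →
  ∃ λ (s : Vec Bool (suc m)) → ∀ i → lookup s (prev i) ≡ lookup d i xor lookup s i
cyclic-antiderivative d sum≡false = suffixXors d , suffixXors-antiderivative d sum≡false
  where
  suffixXors-antiderivative : ∀ {m} (ds : Vec Bool (suc m)) → xorSum ds ≡ false →
    ∀ i → lookup (suffixXors ds) (prev i) ≡ lookup ds i xor lookup (suffixXors ds) i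
  suffixXors-antiderivative (e ∷ es) sum≡false zero    = trans (lookup-suffixXors-last (e ∷ es)) (sym sum≡false)
  suffixXors-antiderivative ds       _         (suc j) = lookup-suffixXors-inject₁ ds j

Switching : ∀ {m} → Circuit (suc m) → Circuit (suc m) → Config (suc m) → Set
Switching C C' s = ∀ i → lookup s (prev i) xor isNeg (lookup C' i) ≡ isNeg (lookup C i) xor lookup s i

lookup-negDiff : ∀ {n} (C C' : Circuit n) i →
  lookup (negDiff C C') i ≡ isNeg (lookup C i) xor isNeg (lookup C' i)
lookup-negDiff C C' i = begin
  lookup (negDiff C C') i                             ≡⟨ lookup-zipWith _xor_ i (map isNeg C) (map isNeg C') ⟩
  lookup (map isNeg C) i xor lookup (map isNeg C') i  ≡⟨ cong₂ _xor_ (lookup-map i isNeg C) (lookup-map i isNeg C') ⟩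
  isNeg (lookup C i) xor isNeg (lookup C' i)          ∎

antiderivative-negDiff⇒Switching : ∀ {m} (C C' : Circuit (suc m)) (s : Config (suc m)) →
  (∀ i → lookup s (prev i) ≡ lookup (negDiff C C') i xor lookup s i) → Switching C C' s
antiderivative-negDiff⇒Switching C C' s s-antiderivative i = begin
  lookup s (prev i) xor n'                 ≡⟨ cong (_xor n') (s-antiderivative i) ⟩
  (lookup (negDiff C C') i xor sᵢ) xor n'  ≡⟨ cong (λ d → (d xor sᵢ) xor n') (lookup-negDiff C C' i) ⟩
  ((n xor n') xor sᵢ) xor n'               ≡⟨ xor-assoc (n xor n') sᵢ n' ⟩
  (n xor n') xor (sᵢ xor n')               ≡⟨ cong ((n xor n') xor_) (xor-comm sᵢ n') ⟩
  (n xor n') xor (n' xor sᵢ)               ≡⟨ xor-assoc n n' (n' xor sᵢ) ⟩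
  n xor (n' xor (n' xor sᵢ))               ≡⟨ cong (n xor_) (sym (xor-assoc n' n' sᵢ)) ⟩
  n xor ((n' xor n') xor sᵢ)               ≡⟨ cong (λ b → n xor (b xor sᵢ)) (xor-same n') ⟩
  n xor sᵢ                                 ∎
  where
  sᵢ n n' : Bool
  sᵢ = lookup s i
  n  = isNeg (lookup C i)
  n' = isNeg (lookup C' i)

translate : ∀ {n} → Vec Bool n → Config n → Config n
translate s x = zipWith _xor_ x s

translate-involutive : ∀ {n} (s x : Vec Bool n) → translate s (translate s x) ≡ x
translate-involutive []      []      = refl
translate-involutive (b ∷ s) (a ∷ x) = cong₂ _∷_ cancel (translate-involutive s x)
  where
  cancel : (a xor b) xor b ≡ a
  cancel = begin
    (a xor b) xor b  ≡⟨ xor-assoc a b b ⟩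
    a xor (b xor b)  ≡⟨ cong (a xor_) (xor-same b) ⟩
    a xor false      ≡⟨ xor-identityʳ a ⟩
    a                ∎

switching-step : ∀ f f' a b b' → b xor isNeg f' ≡ isNeg f xor b' →
                 apply f' (a xor b) ≡ apply f a xor b'
switching-step f f' a b b' switch = begin
  apply f' (a xor b)         ≡⟨ apply≡xor-isNeg f' (a xor b) ⟩
  (a xor b) xor isNeg f'     ≡⟨ xor-assoc a b (isNeg f') ⟩
  a xor (b xor isNeg f')     ≡⟨ cong (a xor_) switch ⟩
  a xor (isNeg f xor b')     ≡⟨ sym (xor-assoc a (isNeg f) b') ⟩
  (a xor isNeg f) xor b'     ≡⟨ cong (_xor b') (sym (apply≡xor-isNeg f a)) ⟩
  apply f a xor b'           ∎

translate-conjugates : ∀ {m} (C C' : Circuit (suc m)) (s : Config (suc m)) → Switching C C' s →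
  ∀ P x → F C' P (translate s x) ≡ translate s (F C P x)
translate-conjugates {m} C C' s switching P x = begin
  F C' P (translate s x)                     ≡⟨ tabulate-cong pointwise ⟩
  tabulate (lookup (translate s (F C P x)))  ≡⟨ tabulate∘lookup (translate s (F C P x)) ⟩
  translate s (F C P x)                      ∎
  where
  update : Circuit (suc m) → Config (suc m) → Fin (suc m) → Bool
  update D y i = if lookup P i then apply (lookup D i) (lookup y (prev i)) else lookup y i

  lookup-translate : ∀ y i → lookup (translate s y) i ≡ lookup y i xor lookup s i
  lookup-translate y i = lookup-zipWith _xor_ i y s

  switch-if : ∀ i p → (if p then apply (lookup C' i) (lookup x (prev i) xor lookup s (prev i))
                             else lookup x i xor lookup s i)
                    ≡ (if p then apply (lookup C i) (lookup x (prev i)) else lookup x i) xor lookup s i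
  switch-if i true  = switching-step (lookup C i) (lookup C' i) (lookup x (prev i))
                                     (lookup s (prev i)) (lookup s i) (switching i)
  switch-if i false = refl

  pointwise : ∀ i → update C' (translate s x) i ≡ lookup (translate s (F C P x)) i
  pointwise i = begin
    update C' (translate s x) i
      ≡⟨ cong₂ (λ u v → if lookup P i then apply (lookup C' i) u else v)
               (lookup-translate x (prev i)) (lookup-translate x i) ⟩
    (if lookup P i then apply (lookup C' i) (lookup x (prev i) xor lookup s (prev i))
                   else lookup x i xor lookup s i)
      ≡⟨ switch-if i (lookup P i) ⟩
    update C x i xor lookup s i
      ≡⟨ cong (_xor lookup s i) (sym (lookup∘tabulate (update C x) i)) ⟩
    lookup (F C P x) i xor lookup s i
      ≡⟨ sym (lookup-translate (F C P x) i) ⟩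
    lookup (translate s (F C P x)) i
      ∎

conjugating-involution⇒GraphIso : ∀ {m} (C C' : Circuit (suc m)) (φ : Config (suc m) → Config (suc m)) →
  (∀ x → φ (φ x) ≡ x) → (∀ P x → F C' P (φ x) ≡ φ (F C P x)) → GraphIso C C'
conjugating-involution⇒GraphIso C C' φ involutive conjugates =
  mk↔ₛ′ φ φ involutive involutive , λ x y → arc-to x y , arc-from x y
  where
  φ-injective : ∀ {x y} → φ x ≡ φ y → x ≡ y
  φ-injective {x} {y} e = trans (sym (involutive x)) (trans (cong φ e) (involutive y))

  arc-to : ∀ x y → Arc C x y → Arc C' (φ x) (φ y)
  arc-to x y (P , nonempty , e) = P , nonempty , trans (conjugates P x) (cong φ e)

  arc-from : ∀ x y → Arc C' (φ x) (φ y) → Arc C x y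
  arc-from x y (P , nonempty , e) = P , nonempty , φ-injective (trans (sym (conjugates P x)) e)

lemma1 : (m : ℕ) → (C C' : Circuit (suc m)) → sign C ≡ sign C' → GraphIso C C'
lemma1 m C C' same-sign =
  let (s , s-antiderivative) = cyclic-antiderivative (negDiff C C') (xorSum-negDiff C C' same-sign)
  in conjugating-involution⇒GraphIso C C' (translate s) (translate-involutive s)
       (translate-conjugates C C' s (antiderivative-negDiff⇒Switching C C' s s-antiderivative))
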